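{- Let $A$ be an approximation algorithm for the MSCSS problem with approximation factor $\alpha$. Consider the following algorithm on a twinless strongly connected directed graph $G=(V,E)$. Let $E_{t}\subseteq E$ be the solution of the MSCSS problem on $G$ computed by $A$. While $(V,E_{t})$ is not twinless strongly connected: compute the twinless strongly connected components of $(V,E_{t})$; pick an edge $(a,b)\in E\setminus E_{t}$ whose endpoints lie in distinct twinless strongly connected components of $(V,E_{t})$; find a simple directed path $p$ from $b$ to $a$ in $(V,E_{t})$; let $S$ be the set of edges $(j,i)$ such that $(i,j)$ is an edge of $p$ whose endpoints lie in distinct twinless strongly connected components of $(V,E_{t})$; set $E_{t}\leftarrow (E_{t}\cup\{(a,b)\})\setminus S$. Output $(V,E_{t})$. Then this algorithm is an $\alpha$-approximation algorithm for the MTSCSS problem.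
   Context: Directed graphs are finite with no loops and no parallel edges. A directed graph is twinless strongly connected if for every pair of vertices $a,b$ there is a directed path $p$ from $a$ to $b$ and a directed path $q$ from $b$ to $a$ such that for every edge $(c,d)$ of $p$, the edge $(d,c)$ is not an edge of $q$. In a directed graph $H$, two vertices are twinless strongly connected if such paths exist in $H$; the equivalence classes are the twinless strongly connected components of $H$. MSCSS problem: given a strongly connected $G=(V,E)$, find a minimum-cardinality $E_{1}\subseteq E$ with $(V,E_{1})$ strongly connected. MTSCSS problem: given a twinless strongly connected $G=(V,E)$, find a minimum-cardinality $E_{1}\subseteq E$ with $(V,E_{1})$ twinless strongly connected. An algorithm has approximation factor $\alpha$ if it always outputs a feasible solution of size at most $\alpha$ times the optimum.
   Formalization: The approximation factor α, both of A and of the resulting algorithm, ranges over the rationals. -}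

module Defs where

open import Data.Nat using (ℕ; zero; suc; _+_)
open import Data.Bool using (Bool; true; false)
open import Data.Fin using (Fin)
open import Data.List using (List; []; _∷_)
open import Data.List.Relation.Unary.Unique.Propositional using (Unique)
open import Data.Product using (Σ; Σ-syntax; ∃; ∃-syntax; _×_; _,_; proj₁)
open import Data.Sum using (_⊎_)
open import Data.Empty using (⊥)
open import Relation.Nullary using (¬_)
open import Relation.Binary.PropositionalEquality using (_≡_)
open import Relation.Binary.Construct.Closure.ReflexiveTransitive using (Star)
open import Induction.WellFounded using (Acc)
open import Function.Bundles using (_⇔_)
open import Data.Integer using (+_)
open import Data.Rational.Unnormalised using (ℚᵘ; mkℚᵘ; _≤_; _*_)

-- A directed graph on vertex set Fin n is given by its edge set,
-- an adjacency function (no parallel edges by construction).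
EdgeSet : ℕ → Set
EdgeSet n = Fin n → Fin n → Bool

Edge : ∀ {n} → EdgeSet n → Fin n → Fin n → Set
Edge E a b = E a b ≡ true

LoopFree : ∀ {n} → EdgeSet n → Set
LoopFree E = ∀ i → E i i ≡ false

_⊆ₑ_ : ∀ {n} → EdgeSet n → EdgeSet n → Set
E₁ ⊆ₑ E = ∀ a b → Edge E₁ a b → Edge E a b

sumFin : ∀ n → (Fin n → ℕ) → ℕ
sumFin zero    f = 0
sumFin (suc n) f = f Fin.zero + sumFin n (λ i → f (Fin.suc i))

b2n : Bool → ℕ
b2n true  = 1
b2n false = 0

size : ∀ {n} → EdgeSet n → ℕ
size {n} E = sumFin n (λ a → sumFin n (λ b → b2n (E a b)))

data Path {n} (E : EdgeSet n) : Fin n → Fin n → Set where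
  []  : ∀ {a} → Path E a a
  _∷_ : ∀ {a b c} → Edge E a b → Path E b c → Path E a c

EdgeOf : ∀ {n} {E : EdgeSet n} {a b} → Path E a b → Fin n → Fin n → Set
EdgeOf []                 c d = ⊥
EdgeOf (_∷_ {a} {b} e p) c d = (c ≡ a × d ≡ b) ⊎ EdgeOf p c d

verts : ∀ {n} {E : EdgeSet n} {a b} → Path E a b → List (Fin n)
verts {a = a} []          = a ∷ []
verts (_∷_ {a} e p)       = a ∷ verts p

Simple : ∀ {n} {E : EdgeSet n} {a b} → Path E a b → Set
Simple p = Unique (verts p)

StronglyConnected : ∀ {n} → EdgeSet n → Set
StronglyConnected {n} E = ∀ (a b : Fin n) → Path E a b

TwinlessConn : ∀ {n} → EdgeSet n → Fin n → Fin n → Set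
TwinlessConn E a b =
  Σ[ p ∈ Path E a b ] Σ[ q ∈ Path E b a ] (∀ c d → EdgeOf p c d → ¬ EdgeOf q d c)

TwinlessStronglyConnected : ∀ {n} → EdgeSet n → Set
TwinlessStronglyConnected {n} E = ∀ (a b : Fin n) → TwinlessConn E a b

tsc⇒sc : ∀ {n} {E : EdgeSet n} → TwinlessStronglyConnected E → StronglyConnected E
tsc⇒sc t a b = proj₁ (t a b)

IsMinSCSS : ∀ {n} → EdgeSet n → EdgeSet n → Set
IsMinSCSS {n} E E* = E* ⊆ₑ E × StronglyConnected E* ×
  (∀ (E₁ : EdgeSet n) → E₁ ⊆ₑ E → StronglyConnected E₁ → size E* Data.Nat.≤ size E₁)

IsMinTSCSS : ∀ {n} → EdgeSet n → EdgeSet n → Set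
IsMinTSCSS {n} E E* = E* ⊆ₑ E × TwinlessStronglyConnected E* ×
  (∀ (E₁ : EdgeSet n) → E₁ ⊆ₑ E → TwinlessStronglyConnected E₁ → size E* Data.Nat.≤ size E₁)

toℚᵘ : ℕ → ℚᵘ
toℚᵘ k = mkℚᵘ (+ k) 0

MSCSSAlgorithm : Set
MSCSSAlgorithm = ∀ {n} (E : EdgeSet n) → LoopFree E → StronglyConnected E → EdgeSet n

ApproxMSCSS : ℚᵘ → MSCSSAlgorithm → Set
ApproxMSCSS α A = ∀ {n} (E : EdgeSet n) (lf : LoopFree E) (sc : StronglyConnected E) →
  (A E lf sc ⊆ₑ E) × StronglyConnected (A E lf sc) ×
  (∀ E* → IsMinSCSS E E* → toℚᵘ (size (A E lf sc)) ≤ α * toℚᵘ (size E*))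

-- One iteration of the while-loop on input graph E, current edge set Et,
-- producing Et′ (any choice of (a,b) and of the simple path p is allowed).
Step : ∀ {n} → EdgeSet n → EdgeSet n → EdgeSet n → Set
Step {n} E Et Et′ =
  ¬ TwinlessStronglyConnected Et ×
  Σ[ a ∈ Fin n ] Σ[ b ∈ Fin n ]
    Edge E a b × Et a b ≡ false × ¬ TwinlessConn Et a b ×
    Σ[ p ∈ Path Et b a ] Simple p ×
      (∀ x y → Edge Et′ x y ⇔
          ((Edge Et x y ⊎ (x ≡ a × y ≡ b)) ×
           -- (x , y) ∉ S  where S = {(j,i) | (i,j) edge of p, i,j in distinct TSCCs of Et}
           ¬ (EdgeOf p y x × ¬ TwinlessConn Et y x)))

Reachable : ∀ {n} → EdgeSet n → EdgeSet n → EdgeSet n → Set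
Reachable E = Star (Step E)

-- Call x, y split in G when they are not twinless connected. The core is a
-- characterisation in a strongly connected G: x, y are twinless connected iff they
-- lie on the same side of every bridge, i.e. of every twin pair (c , d), (d , c)
-- whose deletion leaves c and d mutually unreachable. It is proved by induction on
-- the number of edges, dropping redundant twin arcs. Consequently twinless
-- connectivity is decidable, every path between split vertices has a split edge,
-- and if E is twinless strongly connected while G is not, some edge of E missing
-- from G is split in G. Hence one iteration is always possible, keeps Et strongly
-- connected inside E, does not increase |Et|, and destroys a twin pair; so the loop
-- terminates, and its output satisfies |Et| ≤ |A₀| ≤ α·OPT(MSCSS) ≤ α·OPT(MTSCSS).
module Submission where

open import Defs
open import Data.Nat as ℕ using (ℕ; zero; suc; _+_; z≤n; s≤s)
import Data.Nat.Properties as ℕP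
open import Data.Bool using (Bool; true; false)
import Data.Bool.Properties as 𝔹
open import Data.Fin as Fin using (Fin; _≟_)
open import Data.Fin.Properties as FinP using (any?; all?; injective⇒≤)
open import Algebra.Properties.CommutativeSemigroup ℕP.+-commutativeSemigroup using (xy∙z≈xz∙y)
open import Data.List using (List; []; _∷_; length; lookup)
open import Data.List.Relation.Unary.All as All using ([]; _∷_)
open import Data.List.Relation.Unary.All.Properties using (¬Any⇒All¬)
open import Data.List.Relation.Unary.Any as Any using (here; there)
open import Data.List.Relation.Unary.Unique.Propositional using (Unique)
open import Data.List.Relation.Unary.AllPairs using ([]; _∷_)
open import Data.List.Membership.Propositional using (_∈_)
open import Data.List.Membership.Propositional.Properties using (∈-lookup)
open import Data.Product using (Σ-syntax; ∃-syntax; _×_; _,_; proj₁; proj₂)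
open import Data.Sum using (_⊎_; inj₁; inj₂; [_,_])
open import Data.Empty using (⊥; ⊥-elim)
open import Function using (_∘_)
open import Function.Bundles using (_⇔_; mk⇔; Equivalence)
open import Relation.Nullary using (¬_; Dec; yes; no; does)
open import Relation.Nullary.Decidable using (_×-dec_; _⊎-dec_; _→-dec_; ¬?; decidable-stable; ¬¬-excluded-middle)
open import Relation.Binary.Construct.Closure.ReflexiveTransitive using (ε; _◅_)
open import Induction.WellFounded using (Acc; acc)
open import Relation.Binary.PropositionalEquality using (_≡_; _≢_; refl; sym; trans; cong; subst; subst₂)
open import Data.Integer as ℤ using (+_; -[1+_])
import Data.Integer.Properties as ℤP
open import Data.Rational.Unnormalised using (ℚᵘ; mkℚᵘ; _≤_; _*_; *≤*)
import Data.Rational.Unnormalised.Properties as ℚP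

private variable
  n : ℕ
  a b c d x y : Fin n
  E F G : EdgeSet n

edge? : (G : EdgeSet n) → ∀ x y → Dec (Edge G x y)
edge? G x y = G x y 𝔹.≟ true

⟦_⟧ : {R : Fin n → Fin n → Set} → (∀ x y → Dec (R x y)) → EdgeSet n
⟦ R? ⟧ x y = does (R? x y)

edge-⟦⟧ : {R : Fin n → Fin n → Set} (R? : ∀ x y → Dec (R x y)) → Edge ⟦ R? ⟧ x y ⇔ R x y
edge-⟦⟧ {x = x} {y} R? with R? x y
... | yes r = mk⇔ (λ _ → r) (λ _ → refl)
... | no ¬r = mk⇔ (λ ()) (λ r → ⊥-elim (¬r r))

kept? : {R : Fin n → Fin n → Set} (G : EdgeSet n) → (∀ x y → Dec (R x y)) →
  ∀ x y → Dec (Edge G x y × ¬ R x y)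
kept? G R? x y = edge? G x y ×-dec ¬? (R? x y)

_∖_ : {R : Fin n → Fin n → Set} → EdgeSet n → (∀ x y → Dec (R x y)) → EdgeSet n
G ∖ R? = ⟦ kept? G R? ⟧

module _ {R : Fin n → Fin n → Set} (G : EdgeSet n) (R? : ∀ x y → Dec (R x y)) where

  ∖-⊆ : Edge (G ∖ R?) x y → Edge G x y
  ∖-⊆ e = proj₁ (Equivalence.to (edge-⟦⟧ (kept? G R?)) e)

  ∖-removed : Edge (G ∖ R?) x y → ¬ R x y
  ∖-removed e = proj₂ (Equivalence.to (edge-⟦⟧ (kept? G R?)) e)

  ∖-kept : Edge G x y → ¬ R x y → Edge (G ∖ R?) x y
  ∖-kept e ¬r = Equivalence.from (edge-⟦⟧ (kept? G R?)) (e , ¬r)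

Arc : Fin n → Fin n → Fin n → Fin n → Set
Arc a b x y = x ≡ a × y ≡ b

Twin : Fin n → Fin n → Fin n → Fin n → Set
Twin c d x y = Arc c d x y ⊎ Arc d c x y

arc? : (a b : Fin n) → ∀ x y → Dec (Arc a b x y)
arc? a b x y = (x ≟ a) ×-dec (y ≟ b)

twin? : (c d : Fin n) → ∀ x y → Dec (Twin c d x y)
twin? c d x y = arc? c d x y ⊎-dec arc? d c x y

twin-sym : Twin c d x y → Twin d c x y
twin-sym (inj₁ t) = inj₂ t
twin-sym (inj₂ t) = inj₁ t

_─_ : EdgeSet n → Fin n × Fin n → EdgeSet n
G ─ (a , b) = G ∖ arc? a b

_─⇄_ : EdgeSet n → Fin n × Fin n → EdgeSet n
G ─⇄ (c , d) = G ∖ twin? c d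

─⇄-sym : Edge (G ─⇄ (c , d)) x y → Edge (G ─⇄ (d , c)) x y
─⇄-sym {G = G} {c = c} {d} e =
  ∖-kept G (twin? _ _) (∖-⊆ G (twin? c d) e) (λ t → ∖-removed G (twin? c d) e (twin-sym t))

_++ᵖ_ : Path E a b → Path E b c → Path E a c
[] ++ᵖ q = q
(e ∷ p) ++ᵖ q = e ∷ (p ++ᵖ q)

snoc : Path E a b → Edge E b c → Path E a c
snoc p e = p ++ᵖ (e ∷ [])

_⊑_ : {a b a′ b′ : Fin n} → Path E a b → Path F a′ b′ → Set
p ⊑ q = ∀ c d → EdgeOf p c d → EdgeOf q c d

edgeOf-edge : (p : Path E a b) → EdgeOf p c d → Edge E c d
edgeOf-edge (e ∷ p) (inj₁ (refl , refl)) = e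
edgeOf-edge (e ∷ p) (inj₂ k) = edgeOf-edge p k

edgeOf? : (p : Path E a b) → ∀ c d → Dec (EdgeOf p c d)
edgeOf? [] c d = no λ ()
edgeOf? (_∷_ {a} {b} e p) c d = arc? a b c d ⊎-dec edgeOf? p c d

liftP : (p : Path E a b) → (∀ c d → EdgeOf p c d → Edge F c d) → Path F a b
liftP [] f = []
liftP (_∷_ {a} {b} e p) f = f a b (inj₁ (refl , refl)) ∷ liftP p (λ c d k → f c d (inj₂ k))

liftP-⊑ : (p : Path E a b) (f : ∀ c d → EdgeOf p c d → Edge F c d) → liftP p f ⊑ p
liftP-⊑ (e ∷ p) f c d (inj₁ k) = inj₁ k
liftP-⊑ (e ∷ p) f c d (inj₂ k) = inj₂ (liftP-⊑ p _ c d k)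

mapP : (E ⊆ₑ F) → Path E a b → Path F a b
mapP f p = liftP p (λ c d k → f c d (edgeOf-edge p k))

mapP-⊑ : (f : E ⊆ₑ F) (p : Path E a b) → mapP f p ⊑ p
mapP-⊑ f p = liftP-⊑ p _

start∈ : (p : Path E a b) → a ∈ verts p
start∈ [] = here refl
start∈ (e ∷ p) = here refl

edgeOf-src : (p : Path E a b) → EdgeOf p c d → c ∈ verts p
edgeOf-src (e ∷ p) (inj₁ (refl , refl)) = here refl
edgeOf-src (e ∷ p) (inj₂ k) = there (edgeOf-src p k)

edgeOf-tgt : (p : Path E a b) → EdgeOf p c d → d ∈ verts p
edgeOf-tgt (e ∷ p) (inj₁ (refl , refl)) = there (start∈ p)
edgeOf-tgt (e ∷ p) (inj₂ k) = there (edgeOf-tgt p k)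

takeUntil : (p : Path E a b) → x ∈ verts p → Σ[ t ∈ Path E a x ] t ⊑ p
takeUntil [] (here refl) = [] , λ c d ()
takeUntil (e ∷ p) (here refl) = [] , λ c d ()
takeUntil (e ∷ p) (there m) with takeUntil p m
... | t , t⊑p = (e ∷ t) , λ { c d (inj₁ k) → inj₁ k ; c d (inj₂ k) → inj₂ (t⊑p c d k) }

dropUntil : (p : Path E a b) → x ∈ verts p →
  Σ[ t ∈ Path E x b ] ((Simple p → Simple t) × t ⊑ p)
dropUntil [] (here refl) = [] , (λ s → s) , λ c d ()
dropUntil (e ∷ p) (here refl) = (e ∷ p) , (λ s → s) , λ c d k → k
dropUntil (e ∷ p) (there m) with dropUntil p m
... | t , simple , t⊑p = t , (λ { (_ ∷ s) → simple s }) , λ c d k → inj₂ (t⊑p c d k)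

simplify : (p : Path E a b) → Σ[ t ∈ Path E a b ] (Simple t × t ⊑ p)
simplify [] = [] , [] ∷ [] , λ c d ()
simplify {a = a} (e ∷ p) with simplify p
... | s , simple , s⊑p with Any.any? (a ≟_) (verts s)
...   | yes m = let t , simple′ , t⊑s = dropUntil s m
                in t , simple′ simple , λ c d k → inj₂ (s⊑p c d (t⊑s c d k))
...   | no ¬m = (e ∷ s) , ¬Any⇒All¬ _ ¬m ∷ simple ,
                λ { c d (inj₁ k) → inj₁ k ; c d (inj₂ k) → inj₂ (s⊑p c d k) }

-- A simple path has fewer than n edges: its vertex list has no repetition,
-- so it injects into Fin n.
len : Path E a b → ℕ
len [] = 0
len (e ∷ p) = suc (len p)

lookup-injective : {A : Set} (xs : List A) → Unique xs → ∀ i j → lookup xs i ≡ lookup xs j → i ≡ j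
lookup-injective (x ∷ xs) (_ ∷ u) Fin.zero Fin.zero eq = refl
lookup-injective (x ∷ xs) (x∉ ∷ u) Fin.zero (Fin.suc j) eq = ⊥-elim (All.lookup x∉ (∈-lookup j) eq)
lookup-injective (x ∷ xs) (x∉ ∷ u) (Fin.suc i) Fin.zero eq = ⊥-elim (All.lookup x∉ (∈-lookup i) (sym eq))
lookup-injective (x ∷ xs) (_ ∷ u) (Fin.suc i) (Fin.suc j) eq = cong Fin.suc (lookup-injective xs u i j eq)

length-verts : (p : Path E a b) → length (verts p) ≡ suc (len p)
length-verts [] = refl
length-verts (e ∷ p) = cong suc (length-verts p)

simple-len : {E : EdgeSet n} {a b : Fin n} (p : Path E a b) → Simple p → len p ℕ.< n
simple-len p simple = subst (ℕ._≤ _) (length-verts p)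
  (injective⇒≤ (λ {i} {j} → lookup-injective (verts p) simple i j))

-- Reachability is decidable: search paths of length ≤ k, and k = n suffices.
PathWithin : EdgeSet n → ℕ → Fin n → Fin n → Set
PathWithin E k x y = Σ[ p ∈ Path E x y ] len p ℕ.≤ k

pathWithin? : (E : EdgeSet n) → ∀ k x y → Dec (PathWithin E k x y)
pathWithin? E k x y with x ≟ y
... | yes refl = yes ([] , z≤n)
pathWithin? E zero x y | no x≢y = no λ { ([] , _) → x≢y refl ; ((e ∷ p) , ()) }
pathWithin? E (suc k) x y | no x≢y
  with any? (λ u → edge? E x u ×-dec pathWithin? E k u y)
... | yes (u , e , p , le) = yes ((e ∷ p) , s≤s le)
... | no none = no λ { ([] , _) → x≢y refl ; (_∷_ {b = u} e p , s≤s le) → none (u , e , p , le) }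

path? : (E : EdgeSet n) → ∀ x y → Dec (Path E x y)
path? {n} E x y with pathWithin? E n x y
... | yes (p , _) = yes p
... | no none = no λ p → let s , simple , _ = simplify p in none (s , ℕP.<⇒≤ (simple-len s simple))

module _ (P : Fin n → Set) (P? : ∀ v → Dec (P v)) where

  crossOut : (p : Path E a b) → P a → ¬ P b → Σ[ i ∈ Fin n ] Σ[ j ∈ Fin n ] (EdgeOf p i j × P i × ¬ P j)
  crossOut [] pa ¬pb = ⊥-elim (¬pb pa)
  crossOut (_∷_ {a} {w} e p) pa ¬pb with P? w
  ... | no ¬pw = a , w , inj₁ (refl , refl) , pa , ¬pw
  ... | yes pw = let i , j , k , pi , ¬pj = crossOut p pw ¬pb in i , j , inj₂ k , pi , ¬pj

  crossIn : (p : Path E a b) → ¬ P a → P b → Σ[ i ∈ Fin n ] Σ[ j ∈ Fin n ] (EdgeOf p i j × ¬ P i × P j)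
  crossIn [] ¬pa pb = ⊥-elim (¬pa pb)
  crossIn (_∷_ {a} {w} e p) ¬pa pb with P? w
  ... | yes pw = a , w , inj₁ (refl , refl) , ¬pa , pw
  ... | no ¬pw = let i , j , k , ¬pi , pj = crossIn p ¬pw pb in i , j , inj₂ k , ¬pi , pj

simple-twinless : (p : Path E a b) → Simple p → EdgeOf p c d → ¬ EdgeOf p d c
simple-twinless (e ∷ p) (a∉ ∷ _) (inj₁ (refl , refl)) (inj₁ (refl , b≡a)) = All.lookup a∉ (start∈ p) (sym b≡a)
simple-twinless (e ∷ p) (a∉ ∷ _) (inj₁ (refl , refl)) (inj₂ k′) = All.lookup a∉ (edgeOf-tgt p k′) refl
simple-twinless (e ∷ p) (a∉ ∷ _) (inj₂ k) (inj₁ (refl , refl)) = All.lookup a∉ (edgeOf-tgt p k) refl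
simple-twinless (e ∷ p) (_ ∷ simple) (inj₂ k) (inj₂ k′) = simple-twinless p simple k k′

sumFin-mono : ∀ n {f g : Fin n → ℕ} → (∀ i → f i ℕ.≤ g i) → sumFin n f ℕ.≤ sumFin n g
sumFin-mono zero le = z≤n
sumFin-mono (suc n) le = ℕP.+-mono-≤ (le Fin.zero) (sumFin-mono n (le ∘ Fin.suc))

sumFin-strict : ∀ n {f g : Fin n → ℕ} → (∀ i → f i ℕ.≤ g i) → ∀ k → f k ℕ.< g k →
  sumFin n f ℕ.< sumFin n g
sumFin-strict (suc n) le Fin.zero lt = ℕP.+-mono-<-≤ lt (sumFin-mono n (le ∘ Fin.suc))
sumFin-strict (suc n) le (Fin.suc k) lt = ℕP.+-mono-≤-< (le Fin.zero) (sumFin-strict n (le ∘ Fin.suc) k lt)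

sumFin-except : ∀ n {f g : Fin n → ℕ} {m} k → (∀ i → i ≢ k → f i ℕ.≤ g i) → f k ℕ.≤ g k + m →
  sumFin n f ℕ.≤ sumFin n g + m
sumFin-except (suc n) {f} {g} {m} Fin.zero le lek = begin
  f Fin.zero + sumFin n (f ∘ Fin.suc)     ≤⟨ ℕP.+-mono-≤ lek (sumFin-mono n (λ i → le (Fin.suc i) λ ())) ⟩
  g Fin.zero + m + sumFin n (g ∘ Fin.suc) ≡⟨ xy∙z≈xz∙y (g Fin.zero) m _ ⟩
  g Fin.zero + sumFin n (g ∘ Fin.suc) + m ∎
  where open ℕP.≤-Reasoning
sumFin-except (suc n) {f} {g} {m} (Fin.suc k) le lek = begin
  f Fin.zero + sumFin n (f ∘ Fin.suc)       ≤⟨ ℕP.+-mono-≤ (le Fin.zero λ ()) tail-bound ⟩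
  g Fin.zero + (sumFin n (g ∘ Fin.suc) + m) ≡⟨ ℕP.+-assoc (g Fin.zero) _ m ⟨
  g Fin.zero + sumFin n (g ∘ Fin.suc) + m   ∎
  where
  open ℕP.≤-Reasoning
  tail-bound : sumFin n (f ∘ Fin.suc) ℕ.≤ sumFin n (g ∘ Fin.suc) + m
  tail-bound = sumFin-except n k (λ i i≢k → le (Fin.suc i) (i≢k ∘ FinP.suc-injective)) lek

b2n-mono : {u v : Bool} → (u ≡ true → v ≡ true) → b2n u ℕ.≤ b2n v
b2n-mono {false} h = z≤n
b2n-mono {true} h rewrite h refl = ℕP.≤-refl

b2n-strict : {u v : Bool} → u ≡ true → v ≢ true → b2n v ℕ.< b2n u
b2n-strict {v = false} refl _ = s≤s z≤n
b2n-strict {v = true} refl v≢true = ⊥-elim (v≢true refl)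

b2n≤1 : (u : Bool) → b2n u ℕ.≤ 1
b2n≤1 false = z≤n
b2n≤1 true = ℕP.≤-refl

size-strict : F ⊆ₑ E → Edge E a b → ¬ Edge F a b → size F ℕ.< size E
size-strict {n} {a = a} {b} sub ea ¬fa =
  sumFin-strict n (λ x → sumFin-mono n λ y → b2n-mono (sub x y)) a
    (sumFin-strict n (λ y → b2n-mono (sub a y)) b (b2n-strict ea ¬fa))

size-insert : (∀ x y → Edge F x y → Edge E x y ⊎ Arc a b x y) → size F ℕ.≤ size E + 1
size-insert {n} {F} {E} {a} {b} sub = sumFin-except n a other-row a-row
  where
  entry : ∀ x y → ¬ Arc a b x y → b2n (F x y) ℕ.≤ b2n (E x y)
  entry x y ¬arc = b2n-mono λ e → [ (λ e′ → e′) , (λ arc → ⊥-elim (¬arc arc)) ] (sub x y e)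
  other-row : ∀ x → x ≢ a → sumFin n (λ y → b2n (F x y)) ℕ.≤ sumFin n (λ y → b2n (E x y))
  other-row x x≢a = sumFin-mono n λ y → entry x y (x≢a ∘ proj₁)
  a-row : sumFin n (λ y → b2n (F a y)) ℕ.≤ sumFin n (λ y → b2n (E a y)) + 1
  a-row = sumFin-except n b (λ y y≢b → entry a y (y≢b ∘ proj₂))
    (ℕP.≤-trans (b2n≤1 (F a b)) (ℕP.m≤n+m 1 _))

size-exchange : ∀ {i j} → (∀ x y → Edge F x y → Edge E x y ⊎ Arc a b x y) →
  Edge E i j → ¬ Edge F i j → size F ℕ.≤ size E
size-exchange {F = F} {E} {a} {b} {i} {j} sub eij ¬fij = begin
  size F                   ≤⟨ size-insert sub′ ⟩
  size (E ─ (i , j)) + 1   ≡⟨ ℕP.+-comm _ 1 ⟩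
  suc (size (E ─ (i , j))) ≤⟨ ij-removed ⟩
  size E                   ∎
  where
  open ℕP.≤-Reasoning
  ij-removed : size (E ─ (i , j)) ℕ.< size E
  ij-removed = size-strict {a = i} {b = j} (λ _ _ → ∖-⊆ E (arc? i j)) eij
    (λ e → ∖-removed E (arc? i j) e (refl , refl))
  sub′ : ∀ x y → Edge F x y → Edge (E ─ (i , j)) x y ⊎ Arc a b x y
  sub′ x y e with sub x y e
  ... | inj₂ arc = inj₂ arc
  ... | inj₁ e′ = inj₁ (∖-kept E (arc? i j) e′ λ { (refl , refl) → ¬fij e })

tc-refl : ∀ a → TwinlessConn E a a
tc-refl a = [] , [] , λ c d ()

tc-sym : TwinlessConn E a b → TwinlessConn E b a
tc-sym (p , q , twinless) = q , p , λ c d k k′ → twinless d c k′ k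

tc-mono : E ⊆ₑ F → TwinlessConn E a b → TwinlessConn F a b
tc-mono f (p , q , twinless) =
  mapP f p , mapP f q , λ c d k k′ → twinless c d (mapP-⊑ f p c d k) (mapP-⊑ f q d c k′)

-- In a strongly connected graph an edge whose endpoints are not twinless
-- connected has its twin: otherwise the edge and any return path are twinless.
twin-of-split-edge : StronglyConnected G → Edge G a b → ¬ TwinlessConn G a b → Edge G b a
twin-of-split-edge {G = G} {a} {b} sc e ¬tc with edge? G b a
... | yes e′ = e′
... | no ¬e′ = ⊥-elim (¬tc ((e ∷ []) , sc b a ,
  λ { c d (inj₁ (refl , refl)) k → ¬e′ (edgeOf-edge (sc b a) k) }))

Bridge : EdgeSet n → Fin n → Fin n → Set
Bridge G c d = Edge G c d × ¬ Path (G ─⇄ (c , d)) c d × ¬ Path (G ─⇄ (c , d)) d c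

bridge? : (G : EdgeSet n) → ∀ c d → Dec (Bridge G c d)
bridge? G c d = edge? G c d ×-dec (¬? (path? (G ─⇄ (c , d)) c d) ×-dec ¬? (path? (G ─⇄ (c , d)) d c))

CSide : EdgeSet n → Fin n → Fin n → Fin n → Set
CSide G c d v = Path (G ─⇄ (c , d)) c v

cSide? : (G : EdgeSet n) → ∀ c d v → Dec (CSide G c d v)
cSide? G c d = path? (G ─⇄ (c , d)) c

Separates : EdgeSet n → Fin n → Fin n → Fin n → Fin n → Set
Separates G c d x y = Bridge G c d × ((CSide G c d x × ¬ CSide G c d y) ⊎ (CSide G c d y × ¬ CSide G c d x))

module Sides {G : EdgeSet n} (sc : StronglyConnected G) (c d : Fin n) where

  private
    G⁻ : EdgeSet n
    G⁻ = G ─⇄ (c , d)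

    keep : ∀ {u w} → Edge G u w → ¬ Twin c d u w → Edge G⁻ u w
    keep = ∖-kept G (twin? c d)

  DSide : Fin n → Set
  DSide v = Path G⁻ d v

  -- Every vertex lies on the c-side or the d-side: follow a G-path from c,
  -- restarting at each use of a twin edge.
  cover : ∀ v → CSide G c d v ⊎ DSide v
  cover v = go (sc c v) (inj₁ [])
    where
    go : ∀ {s t} → Path G s t → CSide G c d s ⊎ DSide s → CSide G c d t ⊎ DSide t
    go [] side = side
    go (_∷_ {s} {w} e p) side with twin? c d s w
    ... | yes (inj₁ (_ , refl)) = go p (inj₂ [])
    ... | yes (inj₂ (_ , refl)) = go p (inj₁ [])
    ... | no ¬t = go p (Data.Sum.map (λ r → snoc r (keep e ¬t)) (λ r → snoc r (keep e ¬t)) side)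

  module _ (br : Bridge G c d) where

    -- For a bridge, no vertex lies on both sides: follow a G-path to c until
    -- it first uses a twin edge.
    disjoint : ∀ v → CSide G c d v → DSide v → ⊥
    disjoint v = go (sc v c)
      where
      go : ∀ {s} → Path G s c → CSide G c d s → DSide s → ⊥
      go [] _ fromD = proj₂ (proj₂ br) fromD
      go (_∷_ {s} {w} e p) fromC fromD with twin? c d s w
      ... | yes (inj₁ (refl , _)) = proj₂ (proj₂ br) fromD
      ... | yes (inj₂ (refl , _)) = proj₁ (proj₂ br) fromC
      ... | no ¬t = go p (snoc fromC (keep e ¬t)) (snoc fromD (keep e ¬t))

    leave : ∀ {u w} → Edge G u w → CSide G c d u → ¬ CSide G c d w → Arc c d u w
    leave {u} {w} e cu ¬cw with twin? c d u w
    ... | yes (inj₁ arc) = arc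
    ... | yes (inj₂ (refl , _)) = ⊥-elim (proj₁ (proj₂ br) cu)
    ... | no ¬t = ⊥-elim (¬cw (snoc cu (keep e ¬t)))

    enter : ∀ {u w} → Edge G u w → ¬ CSide G c d u → CSide G c d w → Arc d c u w
    enter {u} {w} e ¬cu cw with twin? c d u w
    ... | yes (inj₂ arc) = arc
    ... | yes (inj₁ (refl , _)) = ⊥-elim (¬cu [])
    ... | no ¬t with cover u
    ...   | inj₁ cu = ⊥-elim (¬cu cu)
    ...   | inj₂ du = ⊥-elim (disjoint w cw (snoc du (keep e ¬t)))

    -- Twinless connected vertices lie on the same side of a bridge: a pair of
    -- twinless paths across it would have to use both (c , d) and (d , c).
    same-side : TwinlessConn G x y → CSide G c d x → CSide G c d y
    same-side {x} {y} (p , q , twinless) cx with cSide? G c d y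
    ... | yes cy = cy
    ... | no ¬cy with crossOut (CSide G c d) (cSide? G c d) p cx ¬cy
                    | crossIn (CSide G c d) (cSide? G c d) q ¬cy cx
    ...   | i , j , k , ci , ¬cj | i′ , j′ , k′ , ¬ci′ , cj′
      with leave (edgeOf-edge p k) ci ¬cj | enter (edgeOf-edge q k′) ¬ci′ cj′
    ...     | refl , refl | refl , refl = ⊥-elim (twinless c d k k′)

    private
      -- After crossing (c , d), a simple path cannot re-enter the c-side: that
      -- needs the edge (d , c), revisiting d.
      ends-off : ∀ {s t} (p : Path G s t) → Simple p → EdgeOf p c d → ¬ CSide G c d t
      ends-off (e ∷ p) (s∉ ∷ _) (inj₁ (refl , refl)) ct
        with crossIn (CSide G c d) (cSide? G c d) p (proj₁ (proj₂ br)) ct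
      ... | i , j , k , ¬ci , cj with enter (edgeOf-edge p k) ¬ci cj
      ...   | refl , refl = All.lookup s∉ (edgeOf-tgt p k) refl
      ends-off (e ∷ p) (_ ∷ simple) (inj₂ k) ct = ends-off p simple k ct

      -- Before crossing (c , d), it cannot come from outside the c-side: entering
      -- needs (d , c), and d is visited again when crossing.
      starts-on : ∀ {s t} (p : Path G s t) → Simple p → EdgeOf p c d → ¬ ¬ CSide G c d s
      starts-on (e ∷ p) _ (inj₁ (refl , refl)) ¬cs = ¬cs []
      starts-on (_∷_ {s} {w} e p) (s∉ ∷ simple) (inj₂ k) ¬cs with cSide? G c d w
      ... | no ¬cw = starts-on p simple k ¬cw
      ... | yes cw with enter e ¬cs cw
      ...   | refl , refl = All.lookup s∉ (edgeOf-tgt p k) refl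

    crossing-separates : ∀ {s t} (p : Path G s t) → Simple p → EdgeOf p c d →
      ¬ (CSide G c d s → CSide G c d t)
    crossing-separates {s} p simple k same with cSide? G c d s
    ... | yes cs = ends-off p simple k (same cs)
    ... | no ¬cs = starts-on p simple k ¬cs

Unseparated : EdgeSet n → Fin n → Fin n → Set
Unseparated G x y = ∀ c d → Bridge G c d →
  (CSide G c d x → CSide G c d y) × (CSide G c d y → CSide G c d x)

tc⇒unseparated : StronglyConnected G → TwinlessConn G x y → Unseparated G x y
tc⇒unseparated sc t c d br = Sides.same-side sc c d br t , Sides.same-side sc c d br (tc-sym t)

-- Dropping (d , c) keeps G strongly connected, and every bridge of
-- the smaller graph is a bridge of G with the same c-side.
module Redundant {G : EdgeSet n} (sc : StronglyConnected G) {c d : Fin n}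
  (cd : Edge G c d) (dc : Edge G d c) (detour : Path (G ─⇄ (c , d)) d c) where

  G₁ : EdgeSet n
  G₁ = G ─ (d , c)

  G₁⊆G : G₁ ⊆ₑ G
  G₁⊆G _ _ = ∖-⊆ G (arc? d c)

  ─⇄⊆G₁ : (G ─⇄ (c , d)) ⊆ₑ G₁
  ─⇄⊆G₁ _ _ e = ∖-kept G (arc? d c) (∖-⊆ G (twin? c d) e) (λ arc → ∖-removed G (twin? c d) e (inj₂ arc))

  -- Uses of (d , c) are replaced by the detour; and one edge fewer.
  strong : StronglyConnected G₁
  strong a b = reroute (sc a b)
    where
    reroute : ∀ {s t} → Path G s t → Path G₁ s t
    reroute [] = []
    reroute (_∷_ {u} {w} e p) with arc? d c u w
    ... | yes (refl , refl) = mapP ─⇄⊆G₁ detour ++ᵖ reroute p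
    ... | no ¬arc = ∖-kept G (arc? d c) e ¬arc ∷ reroute p

  smaller : size G₁ ℕ.< size G
  smaller = size-strict {a = d} {b = c} G₁⊆G dc (λ e → ∖-removed G (arc? d c) e (refl , refl))

  module _ {u v : Fin n} (br₁ : Bridge G₁ u v) where

    private
      G⁻ G₁⁻ : EdgeSet n
      G⁻ = G ─⇄ (u , v)
      G₁⁻ = G₁ ─⇄ (u , v)

      G₁⁻⊆G⁻ : G₁⁻ ⊆ₑ G⁻
      G₁⁻⊆G⁻ _ _ e = ∖-kept G (twin? u v) (G₁⊆G _ _ (∖-⊆ G₁ (twin? u v) e)) (∖-removed G₁ (twin? u v) e)

      -- (u , v) is not the pair c, d: without it, the detour still joins d to c
      -- in G₁. So (c , d) survives in G₁⁻ (unless it is a loop).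
      cd∈G₁⁻ : c ≢ d → Edge G₁⁻ c d
      cd∈G₁⁻ c≢d = ∖-kept G₁ (twin? u v) (∖-kept G (arc? d c) cd (c≢d ∘ proj₁)) not-bridge
        where
        detour₁ : Path (G₁ ─⇄ (c , d)) d c
        detour₁ = mapP (λ x y e → ∖-kept G₁ (twin? c d) (─⇄⊆G₁ x y e) (∖-removed G (twin? c d) e)) detour
        not-bridge : ¬ Twin u v c d
        not-bridge (inj₁ (refl , refl)) = proj₂ (proj₂ br₁) detour₁
        not-bridge (inj₂ (refl , refl)) = proj₁ (proj₂ br₁) (mapP (λ _ _ → ─⇄-sym {G = G₁}) detour₁)

      d⇒c-u : Path G₁⁻ u d → Path G₁⁻ u c
      d⇒c-u ud with c ≟ d
      ... | yes refl = ud
      ... | no c≢d with Sides.cover strong u v c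
      ...   | inj₁ uc = uc
      ...   | inj₂ vc = ⊥-elim (Sides.disjoint strong u v br₁ d ud (snoc vc (cd∈G₁⁻ c≢d)))

      d⇒c-v : Path G₁⁻ v d → Path G₁⁻ v c
      d⇒c-v vd with c ≟ d
      ... | yes refl = vd
      ... | no c≢d with Sides.cover strong u v c
      ...   | inj₂ vc = vc
      ...   | inj₁ uc = ⊥-elim (Sides.disjoint strong u v br₁ d (snoc uc (cd∈G₁⁻ c≢d)) vd)

      -- Reachability from s₀ in G₁⁻ is closed along G⁻-paths, provided it
      -- passes from d to c (the only G⁻-edge that may be missing from G₁⁻).
      transfer : ∀ {s₀} → (Path G₁⁻ s₀ d → Path G₁⁻ s₀ c) →
        ∀ {s t} → Path G₁⁻ s₀ s → Path G⁻ s t → Path G₁⁻ s₀ t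
      transfer d⇒c r [] = r
      transfer d⇒c r (_∷_ {s} {w} e p) with arc? d c s w
      ... | yes (refl , refl) = transfer d⇒c (d⇒c r) p
      ... | no ¬arc = transfer d⇒c
        (snoc r (∖-kept G₁ (twin? u v) (∖-kept G (arc? d c) (∖-⊆ G (twin? u v) e) ¬arc)
                                       (∖-removed G (twin? u v) e))) p

    lift : Bridge G u v
    lift = G₁⊆G u v (proj₁ br₁) ,
           (λ p → proj₁ (proj₂ br₁) (transfer d⇒c-u [] p)) ,
           (λ p → proj₂ (proj₂ br₁) (transfer d⇒c-v [] p))

    c-side : ∀ {z} → CSide G u v z ⇔ CSide G₁ u v z
    c-side = mk⇔ (transfer d⇒c-u []) (mapP G₁⁻⊆G⁻)

  unseparated : Unseparated G x y → Unseparated G₁ x y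
  unseparated uns u v br₁ with uns u v (lift br₁)
  ... | x⇒y , y⇒x = (λ cx → to (x⇒y (from cx))) , (λ cy → to (y⇒x (from cy)))
    where
    to : ∀ {z} → CSide G u v z → CSide G₁ u v z
    to = Equivalence.to (c-side br₁)
    from : ∀ {z} → CSide G₁ u v z → CSide G u v z
    from = Equivalence.from (c-side br₁)

-- Induction on the number of edges: while some twin pair is
-- not a bridge one of its arcs is redundant and can be dropped; once every twin
-- pair is a bridge, simple paths x → y → x are twinless, since a shared twin
-- pair would be a bridge crossed by the x → y path.
unseparated⇒tc : ∀ k → size G ℕ.< k → StronglyConnected G → Unseparated G x y → TwinlessConn G x y
unseparated⇒tc {G = G} {x} {y} (suc k) lt sc uns
  with any? (λ c → any? (λ d →
    edge? G c d ×-dec edge? G d c ×-dec (path? (G ─⇄ (c , d)) c d ⊎-dec path? (G ─⇄ (c , d)) d c)))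
... | yes (c , d , cd , dc , inj₂ detour) =
  tc-mono G₁⊆G (unseparated⇒tc k (ℕP.<-≤-trans smaller (ℕP.≤-pred lt)) strong (unseparated uns))
  where open Redundant sc cd dc detour
... | yes (c , d , cd , dc , inj₁ detour) =
  tc-mono G₁⊆G (unseparated⇒tc k (ℕP.<-≤-trans smaller (ℕP.≤-pred lt)) strong (unseparated uns))
  where open Redundant sc dc cd (mapP (λ _ _ → ─⇄-sym {G = G}) detour)
... | no all-bridges with simplify (sc x y) | simplify (sc y x)
...   | p , simple-p , _ | q , _ , _ = p , q , twinless
  where
  twinless : ∀ i j → EdgeOf p i j → ¬ EdgeOf q j i
  twinless i j k k′ = Sides.crossing-separates sc i j br p simple-p k (proj₁ (uns i j br))
    where
    ij : Edge G i j
    ij = edgeOf-edge p k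
    ji : Edge G j i
    ji = edgeOf-edge q k′
    br : Bridge G i j
    br = ij , (λ r → all-bridges (i , j , ij , ji , inj₁ r)) , (λ r → all-bridges (i , j , ij , ji , inj₂ r))

module _ {G : EdgeSet n} (sc : StronglyConnected G) where

  tc? : ∀ x y → Dec (TwinlessConn G x y)
  tc? x y with all? (λ c → all? (λ d → bridge? G c d →-dec
    ((cSide? G c d x →-dec cSide? G c d y) ×-dec (cSide? G c d y →-dec cSide? G c d x))))
  ... | yes uns = yes (unseparated⇒tc (suc (size G)) ℕP.≤-refl sc uns)
  ... | no ¬uns = no (¬uns ∘ tc⇒unseparated sc)

  separating-bridge : ¬ TwinlessConn G x y → Σ[ c ∈ Fin n ] Σ[ d ∈ Fin n ] Separates G c d x y
  separating-bridge {x} {y} ¬tc with any? (λ c → any? (λ d → bridge? G c d ×-dec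
    ((cSide? G c d x ×-dec ¬? (cSide? G c d y)) ⊎-dec (cSide? G c d y ×-dec ¬? (cSide? G c d x)))))
  ... | yes found = found
  ... | no none = ⊥-elim (¬tc (unseparated⇒tc (suc (size G)) ℕP.≤-refl sc uns))
    where
    uns : Unseparated G x y
    uns c d br = x⇒y , y⇒x
      where
      x⇒y : CSide G c d x → CSide G c d y
      x⇒y cx with cSide? G c d y
      ... | yes cy = cy
      ... | no ¬cy = ⊥-elim (none (c , d , br , inj₁ (cx , ¬cy)))
      y⇒x : CSide G c d y → CSide G c d x
      y⇒x cy with cSide? G c d x
      ... | yes cx = cx
      ... | no ¬cx = ⊥-elim (none (c , d , br , inj₂ (cy , ¬cx)))

  separated⇒split : ∀ {c d} → Separates G c d x y → ¬ TwinlessConn G x y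
  separated⇒split {c = c} {d} (br , inj₁ (cx , ¬cy)) t = ¬cy (Sides.same-side sc c d br t cx)
  separated⇒split {c = c} {d} (br , inj₂ (cy , ¬cx)) t = ¬cx (Sides.same-side sc c d br (tc-sym t) cy)

  -- A path joining two vertices that are not twinless connected has an edge
  -- whose endpoints are not twinless connected: one crossing a separating bridge.
  split-edge-on-path : (p : Path G b a) → ¬ TwinlessConn G a b →
    Σ[ i ∈ Fin n ] Σ[ j ∈ Fin n ] (EdgeOf p i j × ¬ TwinlessConn G i j)
  split-edge-on-path p ¬tc with separating-bridge ¬tc
  ... | c , d , br , inj₁ (ca , ¬cb) =
    let i , j , k , ¬ci , cj = crossIn (CSide G c d) (cSide? G c d) p ¬cb ca
    in i , j , k , separated⇒split (br , inj₂ (cj , ¬ci))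
  ... | c , d , br , inj₂ (cb , ¬ca) =
    let i , j , k , ci , ¬cj = crossOut (CSide G c d) (cSide? G c d) p cb ¬ca
    in i , j , k , separated⇒split (br , inj₁ (ci , ¬cj))

  -- If a supergraph E is twinless strongly connected but G is not, some edge of
  -- E missing from G joins vertices that are not twinless connected in G: the
  -- twinless paths of E across a separating bridge cannot both use its twins.
  SplitMissingEdge : EdgeSet n → Set
  SplitMissingEdge E = Σ[ a ∈ Fin n ] Σ[ b ∈ Fin n ] (Edge E a b × ¬ Edge G a b × ¬ TwinlessConn G a b)

  private
    classify : ∀ {E c d i j} → Separates G c d i j → Edge E i j → Edge G i j ⊎ SplitMissingEdge E
    classify {i = i} {j} sep e with edge? G i j
    ... | yes e′ = inj₁ e′
    ... | no ¬e′ = inj₂ (i , j , e , ¬e′ , separated⇒split sep)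

    across : ∀ {E c d u w} → Bridge G c d → TwinlessConn E u w →
      CSide G c d u → ¬ CSide G c d w → SplitMissingEdge E
    across {c = c} {d} br (p , q , twinless) cu ¬cw
      with crossOut (CSide G c d) (cSide? G c d) p cu ¬cw | crossIn (CSide G c d) (cSide? G c d) q ¬cw cu
    ... | i , j , k , ci , ¬cj | i′ , j′ , k′ , ¬ci′ , cj′
      with classify (br , inj₁ (ci , ¬cj)) (edgeOf-edge p k)
         | classify (br , inj₂ (cj′ , ¬ci′)) (edgeOf-edge q k′)
    ... | inj₂ missing | _ = missing
    ... | inj₁ _ | inj₂ missing = missing
    ... | inj₁ e | inj₁ e′ with Sides.leave sc c d br e ci ¬cj | Sides.enter sc c d br e′ ¬ci′ cj′
    ...   | refl , refl | refl , refl = ⊥-elim (twinless c d k k′)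

  split-missing-edge : ∀ {E} → TwinlessStronglyConnected E → ¬ TwinlessConn G x y → SplitMissingEdge E
  split-missing-edge {x = x} {y} tsc ¬tc with separating-bridge ¬tc
  ... | c , d , br , inj₁ (cx , ¬cy) = across br (tsc x y) cx ¬cy
  ... | c , d , br , inj₂ (cy , ¬cx) = across br (tsc y x) cy ¬cx

non-edge : G x y ≡ false → ¬ Edge G x y
non-edge f e with trans (sym f) e
... | ()

-- The arcs of G whose twin is also in G; each iteration destroys a twin pair.
twinned : EdgeSet n → EdgeSet n
twinned G = ⟦ (λ x y → edge? G x y ×-dec edge? G y x) ⟧

twinned-edge : (G : EdgeSet n) → Edge (twinned G) x y ⇔ (Edge G x y × Edge G y x)
twinned-edge G = edge-⟦⟧ (λ x y → edge? G x y ×-dec edge? G y x)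

module OneStep {E Et Et′ : EdgeSet n} (sc : StronglyConnected Et) {a b : Fin n}
  (ab∈E : Edge E a b) (ab∉Et : ¬ Edge Et a b) (split-ab : ¬ TwinlessConn Et a b)
  (p : Path Et b a) (simple : Simple p)
  (Et′-edge : ∀ x y → Edge Et′ x y ⇔
     ((Edge Et x y ⊎ Arc a b x y) × ¬ (EdgeOf p y x × ¬ TwinlessConn Et y x))) where

  private
    ba∉Et : ¬ Edge Et b a
    ba∉Et ba = ab∉Et (twin-of-split-edge sc ba (split-ab ∘ tc-sym))

    Et′⊆Et+ab : ∀ x y → Edge Et′ x y → Edge Et x y ⊎ Arc a b x y
    Et′⊆Et+ab x y e = proj₁ (Equivalence.to (Et′-edge x y) e)

    -- The path p crosses some edge (i , j) between distinct twinless components;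
    -- its twin (j , i) lies in Et and is deleted.
    crossing : Σ[ i ∈ Fin n ] Σ[ j ∈ Fin n ] (EdgeOf p i j × ¬ TwinlessConn Et i j)
    crossing = split-edge-on-path sc p split-ab
    i j : Fin n
    i = proj₁ crossing
    j = proj₁ (proj₂ crossing)
    ij∈p : EdgeOf p i j
    ij∈p = proj₁ (proj₂ (proj₂ crossing))
    split-ij : ¬ TwinlessConn Et i j
    split-ij = proj₂ (proj₂ (proj₂ crossing))

    ij∈Et : Edge Et i j
    ij∈Et = edgeOf-edge p ij∈p

    ji∈Et : Edge Et j i
    ji∈Et = twin-of-split-edge sc ij∈Et split-ij

    ji∉Et′ : ¬ Edge Et′ j i
    ji∉Et′ e = proj₂ (Equivalence.to (Et′-edge j i) e) (ij∈p , split-ij)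

  -- The only new edge (a , b) comes from E, and at least (j , i) is deleted.
  ⊆E : Et ⊆ₑ E → Et′ ⊆ₑ E
  ⊆E Et⊆E x y e with Et′⊆Et+ab x y e
  ... | inj₁ e′ = Et⊆E x y e′
  ... | inj₂ (refl , refl) = ab∈E

  size-non-increasing : size Et′ ℕ.≤ size Et
  size-non-increasing = size-exchange Et′⊆Et+ab ji∈Et ji∉Et′

  -- No new twin pair appears, as (b , a) ∉ Et, while (i , j), (j , i) is destroyed.
  twins-decrease : size (twinned Et′) ℕ.< size (twinned Et)
  twins-decrease = size-strict {a = j} {b = i} sub
    (Equivalence.from (twinned-edge Et) (ji∈Et , ij∈Et))
    (λ e → ji∉Et′ (proj₁ (Equivalence.to (twinned-edge Et′) e)))
    where
    sub : twinned Et′ ⊆ₑ twinned Et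
    sub x y e with Equivalence.to (twinned-edge Et′) e
    ... | xy , yx with Et′⊆Et+ab x y xy | Et′⊆Et+ab y x yx
    ...   | inj₁ xy′ | inj₁ yx′ = Equivalence.from (twinned-edge Et) (xy′ , yx′)
    ...   | inj₂ (refl , refl) | inj₁ ba = ⊥-elim (ba∉Et ba)
    ...   | inj₁ ba | inj₂ (refl , refl) = ⊥-elim (ba∉Et ba)
    ...   | inj₂ (refl , refl) | inj₂ (refl , a≡b) = ⊥-elim (split-ab (subst (TwinlessConn Et a) a≡b (tc-refl a)))

  private
    -- Edges of the simple path p survive, since p never uses an edge and its twin.
    p⊆Et′ : ∀ u w → EdgeOf p u w → Edge Et′ u w
    p⊆Et′ u w k = Equivalence.from (Et′-edge u w)
      (inj₁ (edgeOf-edge p k) , λ (k′ , _) → simple-twinless p simple k k′)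

    -- (a , b) is added, as p cannot use (b , a) ∉ Et.
    ab∈Et′ : Edge Et′ a b
    ab∈Et′ = Equivalence.from (Et′-edge a b) (inj₂ (refl , refl) , λ (k , _) → ba∉Et (edgeOf-edge p k))

    -- A deleted edge (u , w) reverses an edge of p, so it is bypassed along the
    -- cycle p + (a , b): from u follow p to a, take (a , b), follow p from b to w.
    bypass : ∀ {u w} → EdgeOf p w u → Path Et′ u w
    bypass k with dropUntil p (edgeOf-tgt p k) | takeUntil p (edgeOf-src p k)
    ... | to-a , _ , to-a⊑p | from-b , from-b⊑p =
      liftP to-a (λ c d k′ → p⊆Et′ c d (to-a⊑p c d k′)) ++ᵖ
      (ab∈Et′ ∷ liftP from-b (λ c d k′ → p⊆Et′ c d (from-b⊑p c d k′)))

  -- Every edge of Et is kept or bypassed, so strong connectivity survives.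
  strongly-connected : StronglyConnected Et′
  strongly-connected x y = reroute (sc x y)
    where
    reroute : ∀ {s t} → Path Et s t → Path Et′ s t
    reroute [] = []
    reroute (_∷_ {u} {w} e q) with edgeOf? p w u ×-dec ¬? (tc? sc w u)
    ... | yes (k , _) = bypass k ++ᵖ reroute q
    ... | no kept = Equivalence.from (Et′-edge u w) (inj₁ e , kept) ∷ reroute q

record StepFacts (E Et Et′ : EdgeSet n) : Set where
  field
    strongly-connected  : StronglyConnected Et′
    ⊆E                  : Et ⊆ₑ E → Et′ ⊆ₑ E
    size-non-increasing : size Et′ ℕ.≤ size Et
    twins-decrease      : size (twinned Et′) ℕ.< size (twinned Et)

step-facts : ∀ {E Et Et′ : EdgeSet n} → StronglyConnected Et → Step E Et Et′ → StepFacts E Et Et′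
step-facts {E = E} {Et} sc (_ , a , b , ab∈E , ab≡false , split-ab , p , simple , Et′-edge) = record
  { strongly-connected  = strongly-connected
  ; ⊆E                  = ⊆E
  ; size-non-increasing = size-non-increasing
  ; twins-decrease      = twins-decrease
  }
  where open OneStep {E = E} sc ab∈E (non-edge {G = Et} ab≡false) split-ab p simple Et′-edge

-- Every run from a strongly connected edge set terminates: the number of
-- twinned arcs strictly decreases.
terminates : ∀ {E : EdgeSet n} k Et → StronglyConnected Et → size (twinned Et) ℕ.< k →
  Acc (λ y x → Step E x y) Et
terminates (suc k) Et sc lt = acc λ step →
  let open StepFacts (step-facts sc step)
  in terminates k _ strongly-connected (ℕP.<-≤-trans twins-decrease (ℕP.≤-pred lt))

Invariant : EdgeSet n → EdgeSet n → EdgeSet n → Set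
Invariant E E₀ Et = StronglyConnected Et × Et ⊆ₑ E × size Et ℕ.≤ size E₀

invariant : ∀ {E E₀ Et Et′ : EdgeSet n} → Reachable E Et Et′ → Invariant E E₀ Et → Invariant E E₀ Et′
invariant ε inv = inv
invariant (step ◅ run) (sc , Et⊆E , le) = invariant run
  (strongly-connected , ⊆E Et⊆E , ℕP.≤-trans size-non-increasing le)
  where open StepFacts (step-facts sc step)

-- One iteration can be carried out on any split missing edge (a , b): take a
-- simple path from b to a; the new edge set is computable since twinless
-- connectivity is decidable.
iterate : ∀ {E Et : EdgeSet n} → ¬ TwinlessStronglyConnected Et → StronglyConnected Et →
  Edge E a b → ¬ Edge Et a b → ¬ TwinlessConn Et a b → ∃[ Et′ ] Step E Et Et′
iterate {a = a} {b} {Et = Et} ¬done sc ab∈E ab∉Et split-ab with simplify (sc b a)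
... | p , simple , _ =
  ⟦ keep? ⟧ , ¬done , a , b , ab∈E , 𝔹.¬-not ab∉Et , split-ab , p , simple , λ u v → edge-⟦⟧ keep?
  where
  keep? : ∀ u v → Dec ((Edge Et u v ⊎ Arc a b u v) × ¬ (EdgeOf p v u × ¬ TwinlessConn Et v u))
  keep? u v = (edge? Et u v ⊎-dec arc? a b u v) ×-dec ¬? (edgeOf? p v u ×-dec ¬? (tc? sc v u))

-- The loop never gets stuck: while Et is not twinless strongly connected, some
-- pair is split in Et, hence so is some missing edge of E.
progress : ∀ {E Et : EdgeSet n} → TwinlessStronglyConnected E → StronglyConnected Et →
  TwinlessStronglyConnected Et ⊎ (∃[ Et′ ] Step E Et Et′)
progress {n} tsc sc with all? (λ x → all? (tc? sc x))
... | yes done = inj₁ done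
... | no ¬done with FinP.¬∀⟶∃¬ n _ (λ x → all? (tc? sc x)) ¬done
...   | x , ¬all with FinP.¬∀⟶∃¬ n _ (tc? sc x) ¬all
...     | y , ¬tc with split-missing-edge sc tsc ¬tc
...       | a , b , ab∈E , ab∉Et , split-ab = inj₂ (iterate ¬done sc ab∈E ab∉Et split-ab)

-- A minimum strongly connected spanning subgraph of E exists, classically:
-- from any strongly connected subgraph, descend while a smaller one exists.
minimum-exists : ∀ (E : EdgeSet n) k (E₁ : EdgeSet n) → size E₁ ℕ.< k → E₁ ⊆ₑ E →
  StronglyConnected E₁ → ¬ ¬ (Σ[ M ∈ EdgeSet n ] IsMinSCSS E M)
minimum-exists {n} E (suc k) E₁ lt E₁⊆E sc none = ¬¬-excluded-middle smaller-or-minimal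
  where
  Smaller : Set
  Smaller = Σ[ E₂ ∈ EdgeSet n ] (E₂ ⊆ₑ E × StronglyConnected E₂ × size E₂ ℕ.< size E₁)
  smaller-or-minimal : ¬ Dec Smaller
  smaller-or-minimal (yes (E₂ , E₂⊆E , sc₂ , lt₂)) =
    minimum-exists E k E₂ (ℕP.<-≤-trans lt₂ (ℕP.≤-pred lt)) E₂⊆E sc₂ none
  smaller-or-minimal (no ¬smaller) =
    none (E₁ , E₁⊆E , sc , λ E₂ E₂⊆E sc₂ → ℕP.≮⇒≥ (λ lt₂ → ¬smaller (E₂ , E₂⊆E , sc₂ , lt₂)))

-- A strongly connected graph without edges has at most one vertex, so it is
-- twinless strongly connected.
edgeless-tsc : {G : EdgeSet n} → StronglyConnected G → size G ≡ 0 → TwinlessStronglyConnected G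
edgeless-tsc {n} {G} sc empty x y with sc x y
... | [] = tc-refl x
... | e ∷ _ = ⊥-elim (ℕP.n≮0 (subst (size {n} (λ _ _ → false) ℕ.<_) empty
                          (size-strict {F = λ _ _ → false} {E = G} (λ _ _ ()) e λ ())))

toℚᵘ-mono : ∀ {m k} → m ℕ.≤ k → toℚᵘ m ≤ toℚᵘ k
toℚᵘ-mono {m} {k} le = *≤* (subst₂ ℤ._≤_ (sym (ℤP.*-identityʳ (+ m))) (sym (ℤP.*-identityʳ (+ k))) (ℤ.+≤+ le))

-- Raising the reference optimum from m to e preserves a bound s ≤ α·m, as long as
-- m = 0 forces e = 0; a negative α is impossible when m > 0, as s ≥ 0 > α·m.
scale-bound : ∀ (α : ℚᵘ) {s m e} → toℚᵘ s ≤ α * toℚᵘ m → m ℕ.≤ e → (m ≡ 0 → e ≡ 0) →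
  toℚᵘ s ≤ α * toℚᵘ e
scale-bound α {m = zero} bound _ m≡0⇒e≡0 rewrite m≡0⇒e≡0 refl = bound
scale-bound α@(mkℚᵘ (+ _) _) {m = suc _} bound le _ = ℚP.≤-trans bound (ℚP.*-monoʳ-≤-nonNeg α (toℚᵘ-mono le))
scale-bound α@(mkℚᵘ -[1+ _ ] _) {s} {m = suc m} bound _ _ =
  ⊥-elim (ℚP.<-irrefl ℚP.≃-refl (ℚP.≤-<-trans (ℚP.≤-trans (ℚP.nonNegative⁻¹ (toℚᵘ s)) bound)
                                              (ℚP.negative⁻¹ (α * toℚᵘ (suc m)))))

-- The approximation bound: |Et| ≤ |A₀| ≤ α · OPT(MSCSS) ≤ α · OPT(MTSCSS), since
-- every twinless strongly connected subgraph is strongly connected. The minimum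
-- M exists only classically, which suffices as ≤ on ℚᵘ is decidable.
approximation : ∀ (α : ℚᵘ) {E A₀ Et E* : EdgeSet n} →
  (∀ M → IsMinSCSS E M → toℚᵘ (size A₀) ≤ α * toℚᵘ (size M)) →
  size Et ℕ.≤ size A₀ → IsMinTSCSS E E* → toℚᵘ (size Et) ≤ α * toℚᵘ (size E*)
approximation α {E} {A₀} {Et} {E*} A₀-bound Et≤A₀ (E*⊆E , tsc* , E*-min) =
  decidable-stable (toℚᵘ (size Et) ℚP.≤? α * toℚᵘ (size E*)) λ ¬bound →
    minimum-exists E (suc (size E*)) E* ℕP.≤-refl E*⊆E (tsc⇒sc tsc*) λ (M , M-min@(M⊆E , scM , M-least)) →
      ¬bound (ℚP.≤-trans (toℚᵘ-mono Et≤A₀)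
        (scale-bound α (A₀-bound M M-min) (M-least E* E*⊆E (tsc⇒sc tsc*))
          (λ M-empty → ℕP.n≤0⇒n≡0 (subst (size E* ℕ.≤_) M-empty
             (E*-min M M⊆E (edgeless-tsc scM M-empty))))))

mainTheorem10 : (α : ℚᵘ) (A : MSCSSAlgorithm) → ApproxMSCSS α A →
    ∀ {n} (E : EdgeSet n) (lf : LoopFree E) (tsc : TwinlessStronglyConnected E) →
      -- every run of the loop terminates
      Acc (λ y x → Step E x y) (A E lf (tsc⇒sc tsc)) ×
      -- the loop never gets stuck: the required edge and path can always be chosen
      (∀ Et → Reachable E (A E lf (tsc⇒sc tsc)) Et →
        TwinlessStronglyConnected Et ⊎ (∃[ Et′ ] Step E Et Et′)) ×
      -- every output is a feasible MTSCSS solution within factor α of the optimum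
      (∀ Et → Reachable E (A E lf (tsc⇒sc tsc)) Et → TwinlessStronglyConnected Et →
        (Et ⊆ₑ E) ×
        (∀ E* → IsMinTSCSS E E* → toℚᵘ (size Et) ≤ α * toℚᵘ (size E*)))
mainTheorem10 α A approx {n} E lf tsc with approx E lf (tsc⇒sc tsc)
... | A₀⊆E , sc₀ , A₀-bound =
  terminates (suc (size (twinned A₀))) A₀ sc₀ ℕP.≤-refl ,
  (λ Et run → progress tsc (proj₁ (reached run))) ,
  (λ Et run _ → proj₁ (proj₂ (reached run)) ,
                λ E* opt → approximation α A₀-bound (proj₂ (proj₂ (reached run))) opt)
  where
  A₀ : EdgeSet n
  A₀ = A E lf (tsc⇒sc tsc)
  reached : ∀ {Et} → Reachable E A₀ Et → Invariant E A₀ Et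
  reached run = invariant run (sc₀ , A₀⊆E , ℕP.≤-refl)
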